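{- The folded cubes $\mathrm{FQ}_1$, $\mathrm{FQ}_2$ and $\mathrm{FQ}_3$ are $[1,0,6]$-cycle regular. The folded cubes $\mathrm{FQ}_4$ and $\mathrm{FQ}_6$ are $[1,36,6]$-cycle regular and $[1,200,6]$-cycle regular, respectively. For every integer $n\ge 1$ with $n\notin\{1,2,3,4,6\}$, the folded cube $\mathrm{FQ}_n$ is $[1,4(n-2)(n-1),6]$-cycle regular.
   Context: For $n\ge 1$, the folded cube $\mathrm{FQ}_n$ is the simple graph with vertex set $\{0,1\}^{n-1}$ in which two distinct vertices are adjacent if and only if they differ in exactly one coordinate or one is the coordinatewise complement of the other (equivalently, $\mathrm{FQ}_n$ is obtained from the $n$-dimensional hypercube by identifying antipodal vertices). For integers $l,\lambda,m$, a simple graph is $[l,\lambda,m]$-cycle regular if every path on $l+1$ vertices belongs to exactly $\lambda$ different cycles of length $m$. -}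

module Defs where

open import Data.Nat using (ℕ; zero; suc; _≤_; _∸_)
open import Data.Bool using (Bool; true; false; not; _≟_)
open import Data.Vec using (Vec; []; _∷_; map)
open import Data.List using (List; []; _∷_; _++_; [_]; length)
open import Data.List.Relation.Unary.Linked using (Linked)
open import Data.List.Relation.Unary.Unique.Propositional using (Unique)
open import Data.List.Membership.Propositional using (_∈_)
open import Data.Product using (Σ; ∃; _×_)
open import Data.Sum using (_⊎_)
open import Relation.Binary.PropositionalEquality using (_≡_; _≢_)
open import Relation.Nullary using (yes; no)
open import Function.Bundles using (_⇔_)

close : {V : Set} → List V → List V
close []       = []
close (x ∷ xs) = x ∷ xs ++ [ x ]

IsPath : {V : Set} (E : V → V → Set) (k : ℕ) (p : List V) → Set
IsPath E k p = length p ≡ k × Unique p × Linked E p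

IsCycle : {V : Set} (E : V → V → Set) (m : ℕ) (c : List V) → Set
IsCycle E m c = 3 ≤ m × length c ≡ m × Unique c × Linked E (close c)

-- Each cycle C of length m containing a path p = p₀ … p_l (l ≥ 1, as a
-- subgraph) has exactly one cyclic vertex listing that begins with
-- p₀, p₁, …, p_l (traverse C starting at p₀ in the direction of p₁).
-- So cycles through p correspond bijectively to these listings.
CycleThrough : {V : Set} (E : V → V → Set) (m : ℕ) (p c : List V) → Set
CycleThrough E m p c = IsCycle E m c × ∃ λ rest → c ≡ p ++ rest

HasExactlyCycles : {V : Set} (E : V → V → Set) (m : ℕ) (p : List V) (lam : ℕ) → Set
HasExactlyCycles {V} E m p lam =
  Σ (List (List V)) λ cs →
    Unique cs × (∀ c → (c ∈ cs) ⇔ CycleThrough E m p c) × length cs ≡ lam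

CycleRegular : (V : Set) (E : V → V → Set) (l lam m : ℕ) → Set
CycleRegular V E l lam m =
  ∀ (p : List V) → IsPath E (suc l) p → HasExactlyCycles E m p lam

FQV : ℕ → Set
FQV n = Vec Bool (n ∸ 1)

hamming : {k : ℕ} → Vec Bool k → Vec Bool k → ℕ
hamming []       []       = 0
hamming (a ∷ xs) (b ∷ ys) with a ≟ b
... | yes _ = hamming xs ys
... | no  _ = suc (hamming xs ys)

complement : {k : ℕ} → Vec Bool k → Vec Bool k
complement = map not

FQAdj : (n : ℕ) → FQV n → FQV n → Set
FQAdj n x y = x ≢ y × (hamming x y ≡ 1 ⊎ y ≡ complement x)

module Submission where

-- FQ_n is the Cayley graph of (Z/2)^(n-1) with the n generators e_1, ..., e_(n-1) and the
-- all-ones vector, and the only relation among them is that all n sum to zero.  A 6-cycle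
-- through an edge is thus a word of generators, beginning with the generator of that edge,
-- whose walk visits six distinct vertices and closes up with one more generator.  When
-- n > 6 the relation is too long to occur in a closed word of length 6, so every generator
-- occurs in it an even number of times; with no backtracking this leaves the four shapes
-- x y x z y z, x y z x y z, x y z x z y and x y z y x z, and (n-1)(n-2) choices of y and z.
-- For n <= 6 the words at the origin are counted exhaustively; translations are
-- automorphisms, so this gives the count at every edge.

open import Defs

open import Algebra.Bundles using (CommutativeRing)
open import Data.Bool using (Bool; true; false; _xor_; T)
import Data.Bool as Bool
open import Data.Bool.Properties using (xor-assoc; xor-comm; xor-same; xor-∧-commutativeRing)
open import Data.Empty using (⊥; ⊥-elim)
open import Data.Fin using (Fin; zero; suc; _≟_; punchIn; punchOut; remQuot; combine)
open import Data.Fin.Properties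
  using (any?; all?; injective⇒≤; punchIn-injective; punchInᵢ≢i; punchIn-punchOut; remQuot-combine; combine-remQuot)
open import Data.List
  using (List; []; _∷_; _++_; _∷ʳ_; [_]; foldr; foldl; length; map; filter; allFin; tabulate; inits; cartesianProductWith)
import Data.List as List
open import Data.List.Membership.Propositional using (_∈_; _∉_)
open import Data.List.Membership.Propositional.Properties
  using (∈-map⁺; ∈-map⁻; ∈-filter⁺; ∈-filter⁻; ∈-allFin; ∈-++⁻; ∈-tabulate⁺; ∈-tabulate⁻; ∈-cartesianProductWith⁺)
open import Data.List.Properties
  using (∷-injective; ∷-injectiveˡ; ∷-injectiveʳ; length-map; length-tabulate; map-∘; map-++; foldl-∷ʳ)
open import Data.List.Relation.Binary.Pointwise using (Pointwise; []; _∷_)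
open import Data.List.Relation.Unary.All using ([]; _∷_)
open import Data.List.Relation.Unary.AllPairs using (allPairs?; []; _∷_)
import Data.List.Relation.Unary.AllPairs as AllPairs
import Data.List.Relation.Unary.AllPairs.Properties as AllPairs
open import Data.List.Relation.Unary.Any as Any using (here; there; index)
open import Data.List.Relation.Unary.Any.Properties using (lookup-index)
open import Data.List.Relation.Unary.Linked using (Linked; [-]; _∷_)
open import Data.List.Relation.Unary.Unique.Propositional using (Unique)
import Data.List.Relation.Unary.Unique.Propositional.Properties as Unique
open import Data.Nat using (ℕ; zero; suc; _+_; _*_; _∸_; _<_; _≤_; s≤s; z≤n)
import Data.Nat as ℕ
open import Data.Nat.Properties using (<⇒≱; suc-injective)
open import Data.Product using (∃; ∃₂; _×_; _,_; proj₁; proj₂)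
import Data.Product as Product
open import Data.Sum using (inj₁; inj₂; [_,_]′)
open import Data.Vec using (Vec; []; _∷_; replicate; zipWith; lookup)
import Data.Vec as Vec
open import Data.Vec.Properties using (lookup-replicate; lookup-zipWith; tabulate-cong; ≡-dec)
open import Data.Vec.Relation.Binary.Pointwise.Extensional using (ext; Pointwise-≡⇒≡)
open import Function.Base using (_∘_)
open import Function.Bundles using (mk⇔)
open import Function.Definitions using (Injective)
open import Relation.Binary.PropositionalEquality
  using (_≡_; _≢_; refl; sym; trans; cong; cong₂; subst; ≢-sym; module ≡-Reasoning)
open import Relation.Nullary using (Dec; does; yes; no; ¬?; contradiction)
open import Relation.Nullary.Decidable
  using (True; toWitness; _×-dec_; dec-true; dec-false; does-⇔; decidable-stable)
open import Algebra.Properties.CommutativeSemigroup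
  (CommutativeRing.+-commutativeSemigroup xor-∧-commutativeRing) using (interchange)

private variable
  k m : ℕ

zeros : Vec Bool k
zeros = replicate _ false

infixl 6 _⊕_
_⊕_ : Vec Bool k → Vec Bool k → Vec Bool k
_⊕_ = zipWith _xor_

⊕-assoc : (x y z : Vec Bool k) → x ⊕ y ⊕ z ≡ x ⊕ (y ⊕ z)
⊕-assoc []      []      []      = refl
⊕-assoc (a ∷ x) (b ∷ y) (c ∷ z) = cong₂ _∷_ (xor-assoc a b c) (⊕-assoc x y z)

⊕-comm : (x y : Vec Bool k) → x ⊕ y ≡ y ⊕ x
⊕-comm []      []      = refl
⊕-comm (a ∷ x) (b ∷ y) = cong₂ _∷_ (xor-comm a b) (⊕-comm x y)

⊕-identityˡ : (x : Vec Bool k) → zeros ⊕ x ≡ x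
⊕-identityˡ []      = refl
⊕-identityˡ (a ∷ x) = cong (a ∷_) (⊕-identityˡ x)

⊕-identityʳ : (x : Vec Bool k) → x ⊕ zeros ≡ x
⊕-identityʳ x = trans (⊕-comm x zeros) (⊕-identityˡ x)

⊕-self : (x : Vec Bool k) → x ⊕ x ≡ zeros
⊕-self []      = refl
⊕-self (a ∷ x) = cong₂ _∷_ (xor-same a) (⊕-self x)

⊕-cancelˡ : (x : Vec Bool k) {y z : Vec Bool k} → x ⊕ y ≡ x ⊕ z → y ≡ z
⊕-cancelˡ x {y} {z} eq = begin
  y           ≡⟨ sym (⊕-identityˡ y) ⟩
  zeros ⊕ y   ≡⟨ cong (_⊕ y) (sym (⊕-self x)) ⟩
  x ⊕ x ⊕ y   ≡⟨ ⊕-assoc x x y ⟩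
  x ⊕ (x ⊕ y) ≡⟨ cong (x ⊕_) eq ⟩
  x ⊕ (x ⊕ z) ≡⟨ sym (⊕-assoc x x z) ⟩
  x ⊕ x ⊕ z   ≡⟨ cong (_⊕ z) (⊕-self x) ⟩
  zeros ⊕ z   ≡⟨ ⊕-identityˡ z ⟩
  z           ∎
  where open ≡-Reasoning

-- Generators and letter parities

unit : Fin k → Vec Bool k
unit zero    = true ∷ zeros
unit (suc i) = false ∷ unit i

gen : Fin (suc k) → Vec Bool k
gen zero    = replicate _ true
gen (suc i) = unit i

step : Vec Bool k → Fin (suc k) → Vec Bool k
step v d = v ⊕ gen d

sumGens : List (Fin (suc k)) → Vec Bool k
sumGens = foldr (λ d → gen d ⊕_) zeros

oddIn : Fin m → List (Fin m) → Bool
oddIn b = foldr (λ d → does (d ≟ b) xor_) false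

lookup-unit : (i j : Fin k) → lookup (unit i) j ≡ does (i ≟ j)
lookup-unit zero    zero    = refl
lookup-unit zero    (suc j) = lookup-replicate j false
lookup-unit (suc i) zero    = refl
lookup-unit (suc i) (suc j) = lookup-unit i j

lookup-gen : (d : Fin (suc k)) (j : Fin k) → lookup (gen d) j ≡ does (d ≟ zero) xor does (d ≟ suc j)
lookup-gen zero    j = lookup-replicate j true
lookup-gen (suc i) j = lookup-unit i j

lookup-sumGens : (ds : List (Fin (suc k))) (j : Fin k) →
                 lookup (sumGens ds) j ≡ oddIn zero ds xor oddIn (suc j) ds
lookup-sumGens []       j = lookup-replicate j false
lookup-sumGens (d ∷ ds) j = begin
  lookup (gen d ⊕ sumGens ds) j
    ≡⟨ lookup-zipWith _xor_ j (gen d) (sumGens ds) ⟩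
  lookup (gen d) j xor lookup (sumGens ds) j
    ≡⟨ cong₂ _xor_ (lookup-gen d j) (lookup-sumGens ds j) ⟩
  (does (d ≟ zero) xor does (d ≟ suc j)) xor (oddIn zero ds xor oddIn (suc j) ds)
    ≡⟨ interchange (does (d ≟ zero)) _ _ _ ⟩
  oddIn zero (d ∷ ds) xor oddIn (suc j) (d ∷ ds) ∎
  where open ≡-Reasoning

foldl-step : (a : Vec Bool k) (w : List (Fin (suc k))) → foldl step a w ≡ a ⊕ sumGens w
foldl-step a []      = sym (⊕-identityʳ a)
foldl-step a (d ∷ w) = trans (foldl-step (step a d) w) (⊕-assoc a (gen d) (sumGens w))

sumGens-++ : (ds ds′ : List (Fin (suc k))) → sumGens (ds ++ ds′) ≡ sumGens ds ⊕ sumGens ds′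
sumGens-++ []       ds′ = sym (⊕-identityˡ (sumGens ds′))
sumGens-++ (d ∷ ds) ds′ = trans (cong (gen d ⊕_) (sumGens-++ ds ds′)) (sym (⊕-assoc (gen d) _ _))

oddIn-++ : (b : Fin m) (ds ds′ : List (Fin m)) → oddIn b (ds ++ ds′) ≡ oddIn b ds xor oddIn b ds′
oddIn-++ b []       ds′ = refl
oddIn-++ b (d ∷ ds) ds′ = trans (cong (does (d ≟ b) xor_) (oddIn-++ b ds ds′)) (sym (xor-assoc (does (d ≟ b)) _ _))

xor≡false⇒≡ : ∀ a b → a xor b ≡ false → a ≡ b
xor≡false⇒≡ false false _ = refl
xor≡false⇒≡ true  true  _ = refl

∉⇒oddIn≡false : {b : Fin m} {ds : List (Fin m)} → b ∉ ds → oddIn b ds ≡ false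
∉⇒oddIn≡false {ds = []}     _  = refl
∉⇒oddIn≡false {ds = d ∷ ds} b∉ =
  cong₂ _xor_ (dec-false (d ≟ _) (λ d≡b → b∉ (here (sym d≡b)))) (∉⇒oddIn≡false (λ b∈ → b∉ (there b∈)))

hit : (d : Fin m) → does (d ≟ d) ≡ true
hit d = dec-true (d ≟ d) refl

miss : {d b : Fin m} → d ≢ b → does (d ≟ b) ≡ false
miss = dec-false (_ ≟ _)

tally : (b : Fin m) (ds : List (Fin m)) {βs : List Bool} →
        Pointwise (λ d β → does (d ≟ b) ≡ β) ds βs → oddIn b ds ≡ foldr _xor_ false βs
tally b []       []          = refl
tally b (d ∷ ds) (d≟b ∷ occ) = cong₂ _xor_ d≟b (tally b ds occ)

odd-letter : (ds : List (Fin m)) → (∀ b → oddIn b ds ≡ false) → (b : Fin m) {βs : List Bool} →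
             Pointwise (λ d β → does (d ≟ b) ≡ β) ds βs → T (foldr _xor_ false βs) → ⊥
odd-letter ds even b occurrences odd = subst T (trans (sym (tally b ds occurrences)) (even b)) odd

missing-letter : (ds : List (Fin m)) → length ds < m → ∃ λ b → b ∉ ds
missing-letter ds short with any? (λ b → ¬? (Any.any? (b ≟_) ds))
... | yes found = found
... | no  none  = contradiction (injective⇒≤ index-injective) (<⇒≱ short)
  where
  ∈ds : ∀ b → b ∈ ds
  ∈ds b = decidable-stable (Any.any? (b ≟_) ds) (λ b∉ → none (b , b∉))
  index-injective : ∀ {b c} → index (∈ds b) ≡ index (∈ds c) → b ≡ c
  index-injective {b} {c} eq =
    trans (lookup-index (∈ds b)) (trans (cong (List.lookup ds) eq) (sym (lookup-index (∈ds c))))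

parity-uniform : {ds : List (Fin (suc k))} → sumGens ds ≡ zeros → ∀ b → oddIn b ds ≡ oddIn zero ds
parity-uniform           _        zero    = refl
parity-uniform {ds = ds} zero-sum (suc j) = sym (xor≡false⇒≡ _ _ (begin
  oddIn zero ds xor oddIn (suc j) ds ≡⟨ sym (lookup-sumGens ds j) ⟩
  lookup (sumGens ds) j              ≡⟨ cong (λ v → lookup v j) zero-sum ⟩
  lookup zeros j                     ≡⟨ lookup-replicate j false ⟩
  false                              ∎))
  where open ≡-Reasoning

zero-sum⇒even : {b : Fin (suc k)} {ds : List (Fin (suc k))} →
                b ∉ ds → sumGens ds ≡ zeros → ∀ c → oddIn c ds ≡ false
zero-sum⇒even {b = b} {ds} b∉ zero-sum c =
  trans (parity-uniform {ds = ds} zero-sum c) (trans (sym (parity-uniform {ds = ds} zero-sum b)) (∉⇒oddIn≡false b∉))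

equal-parities⇒equal-sums : (ds ds′ : List (Fin (suc k))) →
                            (∀ b → oddIn b ds ≡ oddIn b ds′) → sumGens ds ≡ sumGens ds′
equal-parities⇒equal-sums ds ds′ same = Pointwise-≡⇒≡ (ext λ j → begin
  lookup (sumGens ds) j                ≡⟨ lookup-sumGens ds j ⟩
  oddIn zero ds xor oddIn (suc j) ds   ≡⟨ cong₂ _xor_ (same zero) (same (suc j)) ⟩
  oddIn zero ds′ xor oddIn (suc j) ds′ ≡⟨ sym (lookup-sumGens ds′ j) ⟩
  lookup (sumGens ds′) j               ∎)
  where open ≡-Reasoning

equal-sums⇒equal-parities : {b : Fin (suc k)} (ds ds′ : List (Fin (suc k))) → b ∉ ds → b ∉ ds′ →
                            sumGens ds ≡ sumGens ds′ → ∀ c → oddIn c ds ≡ oddIn c ds′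
equal-sums⇒equal-parities ds ds′ b∉ds b∉ds′ same c =
  xor≡false⇒≡ _ _ (trans (sym (oddIn-++ c ds ds′)) (zero-sum⇒even b∉ zero-sum c))
  where
  b∉ : _ ∉ ds ++ ds′
  b∉ b∈ = [ b∉ds , b∉ds′ ]′ (∈-++⁻ ds b∈)
  zero-sum : sumGens (ds ++ ds′) ≡ zeros
  zero-sum = trans (sumGens-++ ds ds′) (trans (cong (_⊕ sumGens ds′) same) (⊕-self (sumGens ds′)))

gen-injective : {d d′ : Fin (3 + k)} → gen d ≡ gen d′ → d ≡ d′
gen-injective {d = d} {d′} gd≡gd′ with d′ ≟ d
... | yes d′≡d = sym d′≡d
... | no  d′≢d with missing-letter (d ∷ d′ ∷ []) (s≤s (s≤s (s≤s z≤n)))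
...   | b , b∉ = ⊥-elim (odd-letter (d ∷ d′ ∷ []) (zero-sum⇒even b∉ pair-sum) d (hit d ∷ miss d′≢d ∷ []) _)
  where
  pair-sum : sumGens (d ∷ d′ ∷ []) ≡ zeros
  pair-sum = begin
    gen d ⊕ (gen d′ ⊕ zeros) ≡⟨ cong (gen d ⊕_) (⊕-identityʳ (gen d′)) ⟩
    gen d ⊕ gen d′           ≡⟨ cong (gen d ⊕_) (sym gd≡gd′) ⟩
    gen d ⊕ gen d            ≡⟨ ⊕-self (gen d) ⟩
    zeros                    ∎
    where open ≡-Reasoning

step-injectiveʳ : (v : Vec Bool (2 + k)) {d d′ : Fin (3 + k)} → step v d ≡ step v d′ → d ≡ d′
step-injectiveʳ v eq = gen-injective (⊕-cancelˡ v eq)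

step≢ : (v : Vec Bool (suc k)) (d : Fin (2 + k)) → step v d ≢ v
step≢ v d loop with missing-letter (d ∷ []) (s≤s (s≤s z≤n))
... | b , b∉ = odd-letter (d ∷ []) (zero-sum⇒even b∉ single-sum) d (hit d ∷ []) _
  where
  single-sum : sumGens (d ∷ []) ≡ zeros
  single-sum = trans (⊕-identityʳ (gen d)) (⊕-cancelˡ v (trans loop (sym (⊕-identityʳ v))))

step-step : (v : Vec Bool k) (d : Fin (suc k)) → step (step v d) d ≡ v
step-step v d = trans (⊕-assoc v (gen d) (gen d)) (trans (cong (v ⊕_) (⊕-self (gen d))) (⊕-identityʳ v))

no-backtracking : (v : Vec Bool k) (d d′ : Fin (suc k)) → v ≢ step (step v d) d′ → d ≢ d′
no-backtracking v d _ v≢ refl = v≢ (sym (step-step v d))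

complement≡step-zero : (v : Vec Bool k) → complement v ≡ step v zero
complement≡step-zero []      = refl
complement≡step-zero (a ∷ v) = cong₂ _∷_ (sym (xor-comm a true)) (complement≡step-zero v)

hamming-refl : (v : Vec Bool k) → hamming v v ≡ 0
hamming-refl []          = refl
hamming-refl (true ∷ v)  = hamming-refl v
hamming-refl (false ∷ v) = hamming-refl v

hamming≡0⇒≡ : (u v : Vec Bool k) → hamming u v ≡ 0 → u ≡ v
hamming≡0⇒≡ []          []          _  = refl
hamming≡0⇒≡ (true ∷ u)  (true ∷ v)  eq = cong (true ∷_) (hamming≡0⇒≡ u v eq)
hamming≡0⇒≡ (false ∷ u) (false ∷ v) eq = cong (false ∷_) (hamming≡0⇒≡ u v eq)

hamming-unit : (v : Vec Bool k) (i : Fin k) → hamming v (v ⊕ unit i) ≡ 1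
hamming-unit (a ∷ v) zero = begin
  hamming (a ∷ v) ((a xor true) ∷ v ⊕ zeros) ≡⟨ flipped a ⟩
  suc (hamming v (v ⊕ zeros))                ≡⟨ cong (λ u → suc (hamming v u)) (⊕-identityʳ v) ⟩
  suc (hamming v v)                          ≡⟨ cong suc (hamming-refl v) ⟩
  1                                          ∎
  where
  open ≡-Reasoning
  flipped : ∀ a → hamming (a ∷ v) ((a xor true) ∷ v ⊕ zeros) ≡ suc (hamming v (v ⊕ zeros))
  flipped true  = refl
  flipped false = refl
hamming-unit (true ∷ v)  (suc i) = hamming-unit v i
hamming-unit (false ∷ v) (suc i) = hamming-unit v i

hamming≡1⇒unit : (u v : Vec Bool k) → hamming u v ≡ 1 → ∃ λ i → v ≡ u ⊕ unit i
hamming≡1⇒unit []          []          ()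
hamming≡1⇒unit (true ∷ u)  (true ∷ v)  eq with hamming≡1⇒unit u v eq
... | i , v≡ = suc i , cong (true ∷_) v≡
hamming≡1⇒unit (false ∷ u) (false ∷ v) eq with hamming≡1⇒unit u v eq
... | i , v≡ = suc i , cong (false ∷_) v≡
hamming≡1⇒unit (true ∷ u)  (false ∷ v) eq =
  zero , cong (false ∷_) (trans (sym (hamming≡0⇒≡ u v (suc-injective eq))) (sym (⊕-identityʳ u)))
hamming≡1⇒unit (false ∷ u) (true ∷ v)  eq =
  zero , cong (true ∷_) (trans (sym (hamming≡0⇒≡ u v (suc-injective eq))) (sym (⊕-identityʳ u)))

step-adjacent : (v : Vec Bool (suc k)) (d : Fin (2 + k)) → FQAdj (2 + k) v (step v d)
step-adjacent v zero    = ≢-sym (step≢ v zero) , inj₂ (sym (complement≡step-zero v))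
step-adjacent v (suc i) = ≢-sym (step≢ v (suc i)) , inj₁ (hamming-unit v i)

adjacent⇒step : {u v : Vec Bool k} → FQAdj (suc k) u v → ∃ λ d → v ≡ step u d
adjacent⇒step {u = u} {v} (_ , inj₁ one-flip) with hamming≡1⇒unit u v one-flip
... | i , v≡ = suc i , v≡
adjacent⇒step {u = u} (_ , inj₂ v≡) = zero , trans v≡ (complement≡step-zero u)

-- Cycles through an edge as words

path : Vec Bool k → List (Fin (suc k)) → List (Vec Bool k)
path a []      = []
path a (d ∷ w) = step a d ∷ path (step a d) w

walk : Vec Bool k → List (Fin (suc k)) → List (Vec Bool k)
walk a w = a ∷ path a w

CycleWord : ℕ → Vec Bool k → List (Fin (suc k)) → Set
CycleWord cycleLength a w = suc (length w) ≡ cycleLength × Unique (walk a w) × ∃ λ d → step (foldl step a w) d ≡ a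

length-walk : (a : Vec Bool k) (w : List (Fin (suc k))) → length (walk a w) ≡ suc (length w)
length-walk a []      = refl
length-walk a (d ∷ w) = cong suc (length-walk (step a d) w)

walk-injective : (a : Vec Bool (2 + k)) {w w′ : List (Fin (3 + k))} → walk a w ≡ walk a w′ → w ≡ w′
walk-injective a {[]}    {[]}      _  = refl
walk-injective a {[]}    {_ ∷ _}   ()
walk-injective a {_ ∷ _} {[]}      ()
walk-injective a {d ∷ w} {d′ ∷ w′} eq with step-injectiveʳ a {d} {d′} (∷-injectiveˡ (∷-injectiveʳ eq))
... | refl = cong (d ∷_) (walk-injective (step a d) (∷-injectiveʳ eq))

closing-walk-linked : (a : Vec Bool (suc k)) (w : List (Fin (2 + k))) {b : Vec Bool (suc k)} {d : Fin (2 + k)} →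
                      step (foldl step a w) d ≡ b → Linked (FQAdj (2 + k)) (walk a w ++ [ b ])
closing-walk-linked a []      {d = d} closes = subst (FQAdj (2 + _) a) closes (step-adjacent a d) ∷ [-]
closing-walk-linked a (d ∷ w) {d = e} closes = step-adjacent a d ∷ closing-walk-linked (step a d) w {d = e} closes

linked⇒walk : (a : Vec Bool k) (vs : List (Vec Bool k)) {b : Vec Bool k} → Linked (FQAdj (suc k)) (a ∷ vs ++ [ b ]) →
              ∃ λ w → walk a w ≡ a ∷ vs × ∃ λ d → step (foldl step a w) d ≡ b
linked⇒walk a []       (a~b ∷ [-]) with adjacent⇒step a~b
... | d , b≡ = [] , refl , d , sym b≡
linked⇒walk a (v ∷ vs) (a~v ∷ linked) with adjacent⇒step a~v | linked⇒walk v vs linked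
... | d , refl | w , walk≡ , closes = d ∷ w , cong (a ∷_) walk≡ , closes

module _ {k cycleLength lam : ℕ} (3≤cycleLength : 3 ≤ cycleLength)
         (cycleWords : Fin (3 + k) → List (List (Fin (3 + k))))
         (cycleWords-unique : ∀ d → Unique (cycleWords d))
         (cycleWords-sound : ∀ d a w → w ∈ cycleWords d → CycleWord cycleLength a (d ∷ w))
         (cycleWords-complete : ∀ d a w → CycleWord cycleLength a (d ∷ w) → w ∈ cycleWords d)
         (cycleWords-length : ∀ d → length (cycleWords d) ≡ lam) where

  cycleRegular-by-words : CycleRegular (FQV (3 + k)) (FQAdj (3 + k)) 1 lam cycleLength
  cycleRegular-by-words (a ∷ b ∷ []) (_ , _ , a~b ∷ [-]) with adjacent⇒step a~b
  ... | d , refl = map cycle (cycleWords d) , Unique.map⁺ cycle-injective (cycleWords-unique d)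
                 , (λ c → mk⇔ (to c) (from c)) , trans (length-map cycle (cycleWords d)) (cycleWords-length d)
    where
    cycle : List (Fin (3 + k)) → List (Vec Bool (2 + k))
    cycle w = walk a (d ∷ w)

    cycle-injective : ∀ {w w′} → cycle w ≡ cycle w′ → w ≡ w′
    cycle-injective {w} {w′} eq = ∷-injectiveʳ (walk-injective a {d ∷ w} {d ∷ w′} eq)

    to : ∀ c → c ∈ map cycle (cycleWords d) → CycleThrough (FQAdj (3 + k)) cycleLength (a ∷ step a d ∷ []) c
    to c c∈ with ∈-map⁻ cycle c∈
    ... | w , w∈ , refl with cycleWords-sound d a w w∈
    ...   | length≡ , unique , e , closes =
      (3≤cycleLength , trans (length-walk a (d ∷ w)) length≡ , unique , closing-walk-linked a (d ∷ w) {d = e} closes)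
      , path (step a d) w , refl

    from : ∀ c → CycleThrough (FQAdj (3 + k)) cycleLength (a ∷ step a d ∷ []) c → c ∈ map cycle (cycleWords d)
    from c ((_ , length≡ , unique , linked) , rest , refl) with linked⇒walk a (step a d ∷ rest) linked
    ... | d′ ∷ w , walk≡ , closes with step-injectiveʳ a {d′} {d} (∷-injectiveˡ (∷-injectiveʳ walk≡))
    ...   | refl = subst (_∈ map cycle (cycleWords d)) walk≡ (∈-map⁺ cycle (cycleWords-complete d a w cycleWord))
      where
      cycleWord : CycleWord cycleLength a (d ∷ w)
      cycleWord = trans (sym (length-walk a (d ∷ w))) (trans (cong length walk≡) length≡)
                , subst Unique (sym walk≡) unique , closes

walk-translate : (u a : Vec Bool k) (w : List (Fin (suc k))) → walk (u ⊕ a) w ≡ map (u ⊕_) (walk a w)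
walk-translate u a []      = refl
walk-translate u a (d ∷ w) =
  cong ((u ⊕ a) ∷_) (trans (cong (λ v → walk v w) (⊕-assoc u a (gen d))) (walk-translate u (step a d) w))

cycleWord-translate : ∀ {cycleLength} (u a : Vec Bool k) (w : List (Fin (suc k))) →
                      CycleWord cycleLength a w → CycleWord cycleLength (u ⊕ a) w
cycleWord-translate u a w (length≡ , unique , d , closes) =
  length≡ , subst Unique (sym (walk-translate u a w)) (Unique.map⁺ (⊕-cancelˡ u) unique) , d , (begin
    foldl step (u ⊕ a) w ⊕ gen d ≡⟨ cong (_⊕ gen d) (foldl-step (u ⊕ a) w) ⟩
    u ⊕ a ⊕ sumGens w ⊕ gen d   ≡⟨ cong (_⊕ gen d) (⊕-assoc u a (sumGens w)) ⟩
    u ⊕ (a ⊕ sumGens w) ⊕ gen d ≡⟨ cong (λ v → u ⊕ v ⊕ gen d) (sym (foldl-step a w)) ⟩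
    u ⊕ foldl step a w ⊕ gen d  ≡⟨ ⊕-assoc u (foldl step a w) (gen d) ⟩
    u ⊕ step (foldl step a w) d ≡⟨ cong (u ⊕_) closes ⟩
    u ⊕ a                       ∎)
  where open ≡-Reasoning

cycleWord-rebase : ∀ {cycleLength} (a b : Vec Bool k) (w : List (Fin (suc k))) →
                   CycleWord cycleLength a w → CycleWord cycleLength b w
cycleWord-rebase a b w cw = subst (λ v → CycleWord _ v w) b⊕a⊕a≡b (cycleWord-translate (b ⊕ a) a w cw)
  where
  b⊕a⊕a≡b : b ⊕ a ⊕ a ≡ b
  b⊕a⊕a≡b = trans (⊕-assoc b a a) (trans (cong (b ⊕_) (⊕-self a)) (⊕-identityʳ b))

-- Small folded cubes by enumeration

words : (m l : ℕ) → List (List (Fin m))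
words m zero    = [] ∷ []
words m (suc l) = cartesianProductWith _∷_ (allFin m) (words m l)

words-unique : (m l : ℕ) → Unique (words m l)
words-unique m zero    = [] ∷ []
words-unique m (suc l) = Unique.cartesianProductWith⁺ _∷_ ∷-injective (Unique.allFin⁺ m) (words-unique m l)

∈-words : (w : List (Fin m)) → w ∈ words m (length w)
∈-words []      = here refl
∈-words (d ∷ w) = ∈-cartesianProductWith⁺ _∷_ (∈-allFin d) (∈-words w)

unique? : (vs : List (Vec Bool k)) → Dec (Unique vs)
unique? = allPairs? (λ u v → ¬? (≡-dec Bool._≟_ u v))

cycleWord? : (cycleLength : ℕ) (a : Vec Bool k) (w : List (Fin (suc k))) → Dec (CycleWord cycleLength a w)
cycleWord? cycleLength a w =
  suc (length w) ℕ.≟ cycleLength ×-dec unique? (walk a w) ×-dec any? (λ d → ≡-dec Bool._≟_ (step (foldl step a w) d) a)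

module _ (k cycleLength : ℕ) (3≤cycleLength : 3 ≤ cycleLength) where

  candidates : List (List (Fin (3 + k)))
  candidates = words _ (cycleLength ∸ 2)

  cycleWordFrom? : (d : Fin (3 + k)) (w : List (Fin (3 + k))) → Dec (CycleWord cycleLength zeros (d ∷ w))
  cycleWordFrom? d w = cycleWord? cycleLength zeros (d ∷ w)

  cycleWordsFrom : Fin (3 + k) → List (List (Fin (3 + k)))
  cycleWordsFrom d = filter (cycleWordFrom? d) candidates

  cycleRegular-by-enumeration : {lam : ℕ} → (∀ d → length (cycleWordsFrom d) ≡ lam) →
                                CycleRegular (FQV (3 + k)) (FQAdj (3 + k)) 1 lam cycleLength
  cycleRegular-by-enumeration = cycleRegular-by-words 3≤cycleLength cycleWordsFrom
    (λ d → Unique.filter⁺ (cycleWordFrom? d) (words-unique _ (cycleLength ∸ 2)))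
    (λ d a w w∈ → cycleWord-rebase zeros a (d ∷ w) (proj₂ (∈-filter⁻ (cycleWordFrom? d) {xs = candidates} w∈)))
    (λ d a w cw → ∈-filter⁺ (cycleWordFrom? d) (subst (λ l → w ∈ words _ l) (cong (_∸ 2) (proj₁ cw)) (∈-words w))
                            (cycleWord-rebase a zeros (d ∷ w) cw))

sixCycles-by-enumeration : (k lam : ℕ) →
                           {_ : True (all? λ d → length (cycleWordsFrom k 6 (s≤s (s≤s (s≤s z≤n))) d) ℕ.≟ lam)} →
                           CycleRegular (FQV (3 + k)) (FQAdj (3 + k)) 1 lam 6
sixCycles-by-enumeration k lam {counted} = cycleRegular-by-enumeration k 6 (s≤s (s≤s (s≤s z≤n))) (toWitness counted)

no-cycles : {V : Set} {E : V → V → Set} {l m : ℕ} →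
            (∀ (u v w : V) → u ≢ v → u ≢ w → v ≢ w → ⊥) → CycleRegular V E l 0 m
no-cycles {V} {E} {m = m} no-three p _ = [] , [] , (λ c → mk⇔ (λ ()) (⊥-elim ∘ no-cycle c)) , refl
  where
  no-cycle : ∀ c → CycleThrough E m p c → ⊥
  no-cycle (u ∷ v ∷ w ∷ _) ((_ , _ , (u≢v ∷ u≢w ∷ _) ∷ (v≢w ∷ _) ∷ _ , _) , _) = no-three u v w u≢v u≢w v≢w
  no-cycle []           ((s≤s (s≤s (s≤s _)) , () , _) , _)
  no-cycle (_ ∷ [])     ((s≤s (s≤s (s≤s _)) , () , _) , _)
  no-cycle (_ ∷ _ ∷ []) ((s≤s (s≤s (s≤s _)) , () , _) , _)

FQ₁-no-three-distinct : (u v w : FQV 1) → u ≢ v → u ≢ w → v ≢ w → ⊥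
FQ₁-no-three-distinct [] [] [] u≢v _ _ = u≢v refl

FQ₂-no-three-distinct : (u v w : FQV 2) → u ≢ v → u ≢ w → v ≢ w → ⊥
FQ₂-no-three-distinct (true ∷ [])  (true ∷ [])  _            u≢v _   _   = u≢v refl
FQ₂-no-three-distinct (false ∷ []) (false ∷ []) _            u≢v _   _   = u≢v refl
FQ₂-no-three-distinct (true ∷ [])  (false ∷ []) (true ∷ [])  _   u≢w _   = u≢w refl
FQ₂-no-three-distinct (true ∷ [])  (false ∷ []) (false ∷ []) _   _   v≢w = v≢w refl
FQ₂-no-three-distinct (false ∷ []) (true ∷ [])  (false ∷ []) _   u≢w _   = u≢w refl
FQ₂-no-three-distinct (false ∷ []) (true ∷ [])  (true ∷ [])  _   _   v≢w = v≢w refl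

-- The four shapes of a 6-cycle

parities : List (Fin m) → Vec Bool m
parities q = Vec.tabulate (λ b → oddIn b q)

Unique-map-reflect : {A B C : Set} {f : A → B} {g : A → C} → (∀ {x y} → f x ≡ f y → g x ≡ g y) →
                     (xs : List A) → Unique (map g xs) → Unique (map f xs)
Unique-map-reflect reflect xs unique =
  AllPairs.map⁺ (AllPairs.map (λ gx≢gy fx≡fy → gx≢gy (reflect fx≡fy)) (AllPairs.map⁻ unique))

module _ {k m : ℕ} (σ : Fin m → Fin (suc k)) (σ-injective : Injective _≡_ _≡_ σ) where

  oddIn-map : (b : Fin m) (q : List (Fin m)) → oddIn (σ b) (map σ q) ≡ oddIn b q
  oddIn-map b []      = refl
  oddIn-map b (c ∷ q) = cong₂ _xor_ (does-⇔ (mk⇔ σ-injective (cong σ)) (σ c ≟ σ b) (c ≟ b)) (oddIn-map b q)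

  outside-image : {d : Fin (suc k)} → (∀ c → σ c ≢ d) → (q : List (Fin m)) → d ∉ map σ q
  outside-image outside q d∈ with ∈-map⁻ σ d∈
  ... | c , _ , d≡σc = outside c (sym d≡σc)

  image-misses-a-letter : m < suc k → ∃ λ d → ∀ c → σ c ≢ d
  image-misses-a-letter short with missing-letter (tabulate σ) (subst (_< suc k) (sym (length-tabulate σ)) short)
  ... | d , d∉ = d , λ c σc≡d → d∉ (subst (_∈ tabulate σ) σc≡d (∈-tabulate⁺ c))

  equal-parities⇒equal-sums-map : (q q′ : List (Fin m)) → (∀ b → oddIn b q ≡ oddIn b q′) →
                                  sumGens (map σ q) ≡ sumGens (map σ q′)
  equal-parities⇒equal-sums-map q q′ same = equal-parities⇒equal-sums (map σ q) (map σ q′) same-image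
    where
    same-image : ∀ d → oddIn d (map σ q) ≡ oddIn d (map σ q′)
    same-image d with any? (λ c → σ c ≟ d)
    ... | yes (c , refl) = trans (oddIn-map c q) (trans (same c) (sym (oddIn-map c q′)))
    ... | no  ¬image     = trans (∉⇒oddIn≡false (outside-image outside q))
                                 (sym (∉⇒oddIn≡false (outside-image outside q′)))
      where
      outside : ∀ c → σ c ≢ d
      outside c σc≡d = ¬image (c , σc≡d)

  equal-sums-map⇒equal-parities : m < suc k → (q q′ : List (Fin m)) →
                                  sumGens (map σ q) ≡ sumGens (map σ q′) → ∀ b → oddIn b q ≡ oddIn b q′
  equal-sums-map⇒equal-parities short q q′ same b with image-misses-a-letter short
  ... | d , outside = begin
    oddIn b q              ≡⟨ sym (oddIn-map b q) ⟩
    oddIn (σ b) (map σ q)  ≡⟨ equal-sums⇒equal-parities (map σ q) (map σ q′)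
                                (outside-image outside q) (outside-image outside q′) same (σ b) ⟩
    oddIn (σ b) (map σ q′) ≡⟨ oddIn-map b q′ ⟩
    oddIn b q′             ∎
    where open ≡-Reasoning

  walk-map : (a : Vec Bool k) (u : List (Fin m)) → walk a (map σ u) ≡ map (λ q → foldl step a (map σ q)) (inits u)
  walk-map a []      = refl
  walk-map a (b ∷ u) = cong (a ∷_) (trans (walk-map (step a (σ b)) u) (map-∘ (inits u)))

  unique-walk-map : m < suc k → (a : Vec Bool k) (u : List (Fin m)) →
                    Unique (map parities (inits u)) → Unique (walk a (map σ u))
  unique-walk-map short a u distinct =
    subst Unique (sym (walk-map a u)) (Unique-map-reflect (λ {q} {q′} → same-parities {q} {q′}) (inits u) distinct)
    where
    same-parities : ∀ {q q′} → foldl step a (map σ q) ≡ foldl step a (map σ q′) → parities q ≡ parities q′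
    same-parities {q} {q′} same = tabulate-cong (equal-sums-map⇒equal-parities short q q′
      (⊕-cancelˡ a (trans (sym (foldl-step a (map σ q))) (trans same (foldl-step a (map σ q′))))))

  closed-walk-map : (s : List (Fin m)) → (∀ b → oddIn b s ≡ false) → (a : Vec Bool k) → foldl step a (map σ s) ≡ a
  closed-walk-map s even a = begin
    foldl step a (map σ s) ≡⟨ foldl-step a (map σ s) ⟩
    a ⊕ sumGens (map σ s)  ≡⟨ cong (a ⊕_) (equal-parities⇒equal-sums-map s [] even) ⟩
    a ⊕ zeros              ≡⟨ ⊕-identityʳ a ⟩
    a                      ∎
    where open ≡-Reasoning

-- In a shape the letters X, Y and Z stand for the generators x, y and z: the cycle
-- through the edge labelled x is  x ∷ shape p,  closed by  closing p.
pattern X = zero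
pattern Y = suc zero
pattern Z = suc (suc zero)

shape : Fin 4 → List (Fin 3)
shape zero                   = Y ∷ X ∷ Z ∷ Y ∷ []
shape (suc zero)             = Y ∷ Z ∷ X ∷ Y ∷ []
shape (suc (suc zero))       = Y ∷ Z ∷ X ∷ Z ∷ []
shape (suc (suc (suc zero))) = Y ∷ Z ∷ Y ∷ X ∷ []

closing : Fin 4 → Fin 3
closing zero                   = Z
closing (suc zero)             = Z
closing (suc (suc zero))       = Y
closing (suc (suc (suc zero))) = Z

length-shape : (p : Fin 4) → length (shape p) ≡ 4
length-shape zero                   = refl
length-shape (suc zero)             = refl
length-shape (suc (suc zero))       = refl
length-shape (suc (suc (suc zero))) = refl

shape-path : ∀ p → Unique (map parities (inits (X ∷ shape p)))
shape-path = toWitness {a? = all? λ p → unique? (map parities (inits (X ∷ shape p)))} _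

shape-closes : ∀ p b → oddIn b (X ∷ shape p ∷ʳ closing p) ≡ false
shape-closes = toWitness {a? = all? λ p → all? λ b → oddIn b (X ∷ shape p ∷ʳ closing p) Bool.≟ false} _

triple : {n : ℕ} → Fin n → Fin n → Fin n → Fin 3 → Fin n
triple x y z = Vec.lookup (x ∷ y ∷ z ∷ [])

triple-injective : {n : ℕ} {x y z : Fin n} → y ≢ x → z ≢ x → z ≢ y → Injective _≡_ _≡_ (triple x y z)
triple-injective y≢x z≢x z≢y {X} {X} _  = refl
triple-injective y≢x z≢x z≢y {X} {Y} eq = contradiction (sym eq) y≢x
triple-injective y≢x z≢x z≢y {X} {Z} eq = contradiction (sym eq) z≢x
triple-injective y≢x z≢x z≢y {Y} {X} eq = contradiction eq y≢x
triple-injective y≢x z≢x z≢y {Y} {Y} _  = refl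
triple-injective y≢x z≢x z≢y {Y} {Z} eq = contradiction (sym eq) z≢y
triple-injective y≢x z≢x z≢y {Z} {X} eq = contradiction eq z≢x
triple-injective y≢x z≢x z≢y {Z} {Y} eq = contradiction eq z≢y
triple-injective y≢x z≢x z≢y {Z} {Z} _  = refl

Shaped : {n : ℕ} → Fin n → List (Fin n) → Set
Shaped x w = ∃₂ λ y z → y ≢ x × z ≢ x × z ≢ y × ∃ λ p → w ≡ map (triple x y z) (shape p)

shape-cycleWord : {x y z : Fin (4 + k)} → y ≢ x → z ≢ x → z ≢ y →
                  (p : Fin 4) (a : Vec Bool (3 + k)) → CycleWord 6 a (x ∷ map (triple x y z) (shape p))
shape-cycleWord {k} {x} {y} {z} y≢x z≢x z≢y p a =
  cong (λ l → suc (suc l)) (trans (length-map σ (shape p)) (length-shape p)) ,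
  unique-walk-map σ σ-injective (s≤s (s≤s (s≤s (s≤s z≤n)))) a (X ∷ shape p) (shape-path p) ,
  σ (closing p) , closes
  where
  σ : Fin 3 → Fin (4 + k)
  σ = triple x y z
  σ-injective : Injective _≡_ _≡_ σ
  σ-injective = triple-injective y≢x z≢x z≢y
  u : List (Fin 3)
  u = X ∷ shape p
  closes : step (foldl step a (map σ u)) (σ (closing p)) ≡ a
  closes = begin
    step (foldl step a (map σ u)) (σ (closing p)) ≡⟨ sym (foldl-∷ʳ step a (σ (closing p)) (map σ u)) ⟩
    foldl step a (map σ u ∷ʳ σ (closing p))       ≡⟨ cong (foldl step a) (sym (map-++ σ u [ closing p ])) ⟩
    foldl step a (map σ (u ∷ʳ closing p))         ≡⟨ closed-walk-map σ σ-injective (u ∷ʳ closing p) (shape-closes p) a ⟩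
    a                                             ∎
    where open ≡-Reasoning

shaped-injective : {n : ℕ} (p p′ : Fin 4) (x y z y′ z′ : Fin n) → y ≢ x → z ≢ x → z ≢ y →
                   map (triple x y z) (shape p) ≡ map (triple x y′ z′) (shape p′) → p ≡ p′ × y ≡ y′ × z ≡ z′
shaped-injective zero                   zero                   x y z y′ z′ y≢x z≢x z≢y refl = refl , refl , refl
shaped-injective zero                   (suc zero)             x y z y′ z′ y≢x z≢x z≢y refl = ⊥-elim (z≢x refl)
shaped-injective zero                   (suc (suc zero))       x y z y′ z′ y≢x z≢x z≢y refl = ⊥-elim (y≢x refl)
shaped-injective zero                   (suc (suc (suc zero))) x y z y′ z′ y≢x z≢x z≢y refl = ⊥-elim (y≢x refl)
shaped-injective (suc zero)             zero                   x y z y′ z′ y≢x z≢x z≢y refl = ⊥-elim (z≢x refl)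
shaped-injective (suc zero)             (suc zero)             x y z y′ z′ y≢x z≢x z≢y refl = refl , refl , refl
shaped-injective (suc zero)             (suc (suc zero))       x y z y′ z′ y≢x z≢x z≢y refl = ⊥-elim (z≢y refl)
shaped-injective (suc zero)             (suc (suc (suc zero))) x y z y′ z′ y≢x z≢x z≢y refl = ⊥-elim (y≢x refl)
shaped-injective (suc (suc zero))       zero                   x y z y′ z′ y≢x z≢x z≢y refl = ⊥-elim (z≢x refl)
shaped-injective (suc (suc zero))       (suc zero)             x y z y′ z′ y≢x z≢x z≢y refl = ⊥-elim (z≢y refl)
shaped-injective (suc (suc zero))       (suc (suc zero))       x y z y′ z′ y≢x z≢x z≢y refl = refl , refl , refl
shaped-injective (suc (suc zero))       (suc (suc (suc zero))) x y z y′ z′ y≢x z≢x z≢y refl = ⊥-elim (y≢x refl)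
shaped-injective (suc (suc (suc zero))) zero                   x y z y′ z′ y≢x z≢x z≢y refl = ⊥-elim (z≢x refl)
shaped-injective (suc (suc (suc zero))) (suc zero)             x y z y′ z′ y≢x z≢x z≢y refl = ⊥-elim (y≢x refl)
shaped-injective (suc (suc (suc zero))) (suc (suc zero))       x y z y′ z′ y≢x z≢x z≢y refl = ⊥-elim (y≢x refl)
shaped-injective (suc (suc (suc zero))) (suc (suc (suc zero))) x y z y′ z′ y≢x z≢x z≢y refl = refl , refl , refl

-- Classification of the closed words

module _ {n : ℕ} (x y : Fin n) (x≢y : x ≢ y) where

  classify-xyx : (d₄ d₅ d₆ : Fin n) → x ≢ d₄ → d₄ ≢ d₅ → d₅ ≢ d₆ → d₆ ≢ x →
                 (∀ b → oddIn b (x ∷ y ∷ x ∷ d₄ ∷ d₅ ∷ d₆ ∷ []) ≡ false) → Shaped x (y ∷ x ∷ d₄ ∷ d₅ ∷ [])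
  classify-xyx d₄ d₅ d₆ x≢d₄ d₄≢d₅ d₅≢d₆ d₆≢x even with d₄ ≟ y | d₅ ≟ x | d₅ ≟ y | d₆ ≟ d₄
  ... | yes refl | yes refl | _ | _ =
    ⊥-elim (odd-letter (x ∷ y ∷ x ∷ y ∷ x ∷ d₆ ∷ []) even x
      (hit x ∷ miss (≢-sym x≢y) ∷ hit x ∷ miss (≢-sym x≢y) ∷ hit x ∷ miss d₆≢x ∷ []) _)
  ... | yes refl | no d₅≢x | _ | _ =
    ⊥-elim (odd-letter (x ∷ y ∷ x ∷ y ∷ d₅ ∷ d₆ ∷ []) even d₅
      (miss (≢-sym d₅≢x) ∷ miss d₄≢d₅ ∷ miss (≢-sym d₅≢x) ∷ miss d₄≢d₅ ∷ hit d₅ ∷ miss (≢-sym d₅≢d₆) ∷ []) _)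
  ... | no d₄≢y | yes refl | _ | _ =
    ⊥-elim (odd-letter (x ∷ y ∷ x ∷ d₄ ∷ x ∷ d₆ ∷ []) even x
      (hit x ∷ miss (≢-sym x≢y) ∷ hit x ∷ miss (≢-sym x≢d₄) ∷ hit x ∷ miss d₆≢x ∷ []) _)
  ... | no d₄≢y | no d₅≢x | no d₅≢y | _ =
    ⊥-elim (odd-letter (x ∷ y ∷ x ∷ d₄ ∷ d₅ ∷ d₆ ∷ []) even d₅
      (miss (≢-sym d₅≢x) ∷ miss (≢-sym d₅≢y) ∷ miss (≢-sym d₅≢x) ∷ miss d₄≢d₅ ∷ hit d₅ ∷ miss (≢-sym d₅≢d₆) ∷ []) _)
  ... | no d₄≢y | no d₅≢x | yes refl | yes refl = y , d₄ , ≢-sym x≢y , ≢-sym x≢d₄ , d₄≢y , zero , refl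
  ... | no d₄≢y | no d₅≢x | yes refl | no d₆≢d₄ =
    ⊥-elim (odd-letter (x ∷ y ∷ x ∷ d₄ ∷ y ∷ d₆ ∷ []) even d₄
      (miss x≢d₄ ∷ miss (≢-sym d₄≢y) ∷ miss x≢d₄ ∷ hit d₄ ∷ miss (≢-sym d₄≢y) ∷ miss d₆≢d₄ ∷ []) _)

  module _ (z : Fin n) (z≢x : z ≢ x) (y≢z : y ≢ z) where

    classify-xyzx : (d₅ d₆ : Fin n) → x ≢ d₅ → d₅ ≢ d₆ → d₆ ≢ x →
                    (∀ b → oddIn b (x ∷ y ∷ z ∷ x ∷ d₅ ∷ d₆ ∷ []) ≡ false) → Shaped x (y ∷ z ∷ x ∷ d₅ ∷ [])
    classify-xyzx d₅ d₆ x≢d₅ d₅≢d₆ d₆≢x even with d₅ ≟ y | d₅ ≟ z | d₆ ≟ y | d₆ ≟ z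
    ... | yes refl | _ | _ | yes refl = y , z , ≢-sym x≢y , z≢x , ≢-sym y≢z , suc zero , refl
    ... | yes refl | _ | _ | no d₆≢z =
      ⊥-elim (odd-letter (x ∷ y ∷ z ∷ x ∷ y ∷ d₆ ∷ []) even z
        (miss (≢-sym z≢x) ∷ miss y≢z ∷ hit z ∷ miss (≢-sym z≢x) ∷ miss y≢z ∷ miss d₆≢z ∷ []) _)
    ... | no d₅≢y | yes refl | yes refl | _ = y , z , ≢-sym x≢y , z≢x , ≢-sym y≢z , suc (suc zero) , refl
    ... | no d₅≢y | yes refl | no d₆≢y | _ =
      ⊥-elim (odd-letter (x ∷ y ∷ z ∷ x ∷ z ∷ d₆ ∷ []) even y
        (miss x≢y ∷ hit y ∷ miss (≢-sym y≢z) ∷ miss x≢y ∷ miss (≢-sym y≢z) ∷ miss d₆≢y ∷ []) _)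
    ... | no d₅≢y | no d₅≢z | _ | _ =
      ⊥-elim (odd-letter (x ∷ y ∷ z ∷ x ∷ d₅ ∷ d₆ ∷ []) even d₅
        (miss x≢d₅ ∷ miss (≢-sym d₅≢y) ∷ miss (≢-sym d₅≢z) ∷ miss x≢d₅ ∷ hit d₅ ∷ miss (≢-sym d₅≢d₆) ∷ []) _)

    classify-xyzy : (d₅ d₆ : Fin n) → y ≢ d₅ → d₅ ≢ d₆ → d₆ ≢ x →
                    (∀ b → oddIn b (x ∷ y ∷ z ∷ y ∷ d₅ ∷ d₆ ∷ []) ≡ false) → Shaped x (y ∷ z ∷ y ∷ d₅ ∷ [])
    classify-xyzy d₅ d₆ y≢d₅ d₅≢d₆ d₆≢x even with d₅ ≟ x | d₆ ≟ z
    ... | yes refl | yes refl = y , z , ≢-sym x≢y , z≢x , ≢-sym y≢z , suc (suc (suc zero)) , refl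
    ... | yes refl | no d₆≢z =
      ⊥-elim (odd-letter (x ∷ y ∷ z ∷ y ∷ x ∷ d₆ ∷ []) even z
        (miss (≢-sym z≢x) ∷ miss y≢z ∷ hit z ∷ miss y≢z ∷ miss (≢-sym z≢x) ∷ miss d₆≢z ∷ []) _)
    ... | no d₅≢x | _ =
      ⊥-elim (odd-letter (x ∷ y ∷ z ∷ y ∷ d₅ ∷ d₆ ∷ []) even x
        (hit x ∷ miss (≢-sym x≢y) ∷ miss z≢x ∷ miss (≢-sym x≢y) ∷ miss d₅≢x ∷ miss d₆≢x ∷ []) _)

    classify-xyzw : (w d₅ d₆ : Fin n) → z ≢ w → w ≢ x → w ≢ y → d₅ ≢ d₆ → d₆ ≢ x →
                    (∀ b → oddIn b (x ∷ y ∷ z ∷ w ∷ d₅ ∷ d₆ ∷ []) ≡ false) → Shaped x (y ∷ z ∷ w ∷ d₅ ∷ [])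
    classify-xyzw w d₅ d₆ z≢w w≢x w≢y d₅≢d₆ d₆≢x even with d₅ ≟ x | d₆ ≟ y
    ... | yes refl | yes refl =
      ⊥-elim (odd-letter (x ∷ y ∷ z ∷ w ∷ x ∷ y ∷ []) even z
        (miss (≢-sym z≢x) ∷ miss y≢z ∷ hit z ∷ miss (≢-sym z≢w) ∷ miss (≢-sym z≢x) ∷ miss y≢z ∷ []) _)
    ... | yes refl | no d₆≢y =
      ⊥-elim (odd-letter (x ∷ y ∷ z ∷ w ∷ x ∷ d₆ ∷ []) even y
        (miss x≢y ∷ hit y ∷ miss (≢-sym y≢z) ∷ miss w≢y ∷ miss x≢y ∷ miss d₆≢y ∷ []) _)
    ... | no d₅≢x | _ =
      ⊥-elim (odd-letter (x ∷ y ∷ z ∷ w ∷ d₅ ∷ d₆ ∷ []) even x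
        (hit x ∷ miss (≢-sym x≢y) ∷ miss z≢x ∷ miss w≢x ∷ miss d₅≢x ∷ miss d₆≢x ∷ []) _)

  classify : (d₃ d₄ d₅ d₆ : Fin n) → y ≢ d₃ → d₃ ≢ d₄ → d₄ ≢ d₅ → d₅ ≢ d₆ → d₆ ≢ x →
             (∀ b → oddIn b (x ∷ y ∷ d₃ ∷ d₄ ∷ d₅ ∷ d₆ ∷ []) ≡ false) → Shaped x (y ∷ d₃ ∷ d₄ ∷ d₅ ∷ [])
  classify d₃ d₄ d₅ d₆ y≢d₃ d₃≢d₄ d₄≢d₅ d₅≢d₆ d₆≢x even with d₃ ≟ x | d₄ ≟ x | d₄ ≟ y
  ... | yes refl | _        | _        = classify-xyx d₄ d₅ d₆ d₃≢d₄ d₄≢d₅ d₅≢d₆ d₆≢x even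
  ... | no d₃≢x  | yes refl | _        = classify-xyzx d₃ d₃≢x y≢d₃ d₅ d₆ d₄≢d₅ d₅≢d₆ d₆≢x even
  ... | no d₃≢x  | no _     | yes refl = classify-xyzy d₃ d₃≢x y≢d₃ d₅ d₆ d₄≢d₅ d₅≢d₆ d₆≢x even
  ... | no d₃≢x  | no d₄≢x  | no d₄≢y  =
    classify-xyzw d₃ d₃≢x y≢d₃ d₄ d₅ d₆ d₃≢d₄ d₄≢x d₄≢y d₅≢d₆ d₆≢x even

cycleWord⇒shaped : (a : Vec Bool (6 + k)) (x : Fin (7 + k)) (w : List (Fin (7 + k))) → CycleWord 6 a (x ∷ w) → Shaped x w
cycleWord⇒shaped {k} a x (y ∷ d₃ ∷ d₄ ∷ d₅ ∷ [])
  (_ , ((_ ∷ a≢v₂ ∷ _ ∷ a≢v₄ ∷ _ ∷ []) ∷ (_ ∷ v₁≢v₃ ∷ _ ∷ v₁≢v₅ ∷ []) ∷ (_ ∷ v₂≢v₄ ∷ _) ∷ (_ ∷ v₃≢v₅ ∷ []) ∷ _) , d₆ , closes)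
  = classify x y (no-backtracking a x y a≢v₂) d₃ d₄ d₅ d₆
      (no-backtracking v₁ y d₃ v₁≢v₃) (no-backtracking v₂ d₃ d₄ v₂≢v₄) (no-backtracking v₃ d₄ d₅ v₃≢v₅)
      (no-backtracking v₄ d₅ d₆ (≢-sym (subst (_≢ v₄) (sym closes) a≢v₄)))
      (no-backtracking v₅ d₆ x (≢-sym (subst (λ v → step v x ≢ v₅) (sym closes) v₁≢v₅)))
      even
  where
  v₁ v₂ v₃ v₄ v₅ : Vec Bool (6 + k)
  v₁ = step a x
  v₂ = step v₁ y
  v₃ = step v₂ d₃
  v₄ = step v₃ d₄
  v₅ = step v₄ d₅
  ds : List (Fin (7 + k))
  ds = x ∷ y ∷ d₃ ∷ d₄ ∷ d₅ ∷ d₆ ∷ []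
  zero-sum : sumGens ds ≡ zeros
  zero-sum = ⊕-cancelˡ a (trans (sym (foldl-step a ds)) (trans closes (sym (⊕-identityʳ a))))
  even : ∀ b → oddIn b ds ≡ false
  even with missing-letter ds (s≤s (s≤s (s≤s (s≤s (s≤s (s≤s (s≤s z≤n)))))))
  ... | b , b∉ = zero-sum⇒even b∉ zero-sum
cycleWord⇒shaped a x []                      (() , _)
cycleWord⇒shaped a x (_ ∷ [])                (() , _)
cycleWord⇒shaped a x (_ ∷ _ ∷ [])            (() , _)
cycleWord⇒shaped a x (_ ∷ _ ∷ _ ∷ [])        (() , _)
cycleWord⇒shaped a x (_ ∷ _ ∷ _ ∷ _ ∷ _ ∷ _) (() , _)

-- Large folded cubes

module _ (k : ℕ) where

  Index : Set
  Index = (Fin 4 × Fin (5 + k)) × Fin (6 + k)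

  decode : Fin (4 * (5 + k) * (6 + k)) → Index
  decode t = Product.map₁ (remQuot {4} (5 + k)) (remQuot {4 * (5 + k)} (6 + k) t)

  encode : Index → Fin (4 * (5 + k) * (6 + k))
  encode ((p , j) , i) = combine (combine p j) i

  decode-injective : ∀ {t t′} → decode t ≡ decode t′ → t ≡ t′
  decode-injective {t} {t′} eq = trans (sym (encode∘decode t)) (trans (cong encode eq) (encode∘decode t′))
    where
    encode∘decode : (t : Fin (4 * (5 + k) * (6 + k))) → encode (decode t) ≡ t
    encode∘decode t = trans (cong (λ pj → combine pj (proj₂ (remQuot {4 * (5 + k)} (6 + k) t)))
                                  (combine-remQuot {4} (5 + k) (proj₁ (remQuot {4 * (5 + k)} (6 + k) t))))
                            (combine-remQuot {4 * (5 + k)} (6 + k) t)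

  decode∘encode : ∀ c → decode (encode c) ≡ c
  decode∘encode ((p , j) , i) =
    trans (cong (Product.map₁ (remQuot {4} (5 + k))) (remQuot-combine (combine p j) i)) (cong (_, i) (remQuot-combine p j))

  cycleWordOf : Fin (7 + k) → Index → List (Fin (7 + k))
  cycleWordOf x ((p , j) , i) = map (triple x (punchIn x i) (punchIn x (punchIn i j))) (shape p)

  punchIn-punchIn≢punchIn : (x : Fin (7 + k)) (i : Fin (6 + k)) (j : Fin (5 + k)) → punchIn x (punchIn i j) ≢ punchIn x i
  punchIn-punchIn≢punchIn x i j eq = punchInᵢ≢i i j (punchIn-injective x _ _ eq)

  cycleWordOf-cycleWord : ∀ x c a → CycleWord 6 a (x ∷ cycleWordOf x c)
  cycleWordOf-cycleWord x ((p , j) , i) =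
    shape-cycleWord (punchInᵢ≢i x i) (punchInᵢ≢i x (punchIn i j)) (punchIn-punchIn≢punchIn x i j) p

  cycleWordOf-injective : ∀ x {c c′} → cycleWordOf x c ≡ cycleWordOf x c′ → c ≡ c′
  cycleWordOf-injective x {(p , j) , i} {(p′ , j′) , i′} eq
    with shaped-injective p p′ x _ _ _ _ (punchInᵢ≢i x i) (punchInᵢ≢i x (punchIn i j)) (punchIn-punchIn≢punchIn x i j) eq
  ... | refl , y≡ , z≡ with punchIn-injective x i i′ y≡
  ... | refl with punchIn-injective i j j′ (punchIn-injective x _ _ z≡)
  ... | refl = refl

  shaped⇒cycleWordOf : ∀ x w → Shaped x w → ∃ λ c → w ≡ cycleWordOf x c
  shaped⇒cycleWordOf x w (y , z , y≢x , z≢x , z≢y , p , refl) = ((p , j) , i) , word≡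
    where
    i i′ : Fin (6 + k)
    i  = punchOut (≢-sym y≢x)
    i′ = punchOut (≢-sym z≢x)
    i≢i′ : i ≢ i′
    i≢i′ eq = z≢y (begin
      z                ≡⟨ sym (punchIn-punchOut (≢-sym z≢x)) ⟩
      punchIn x i′     ≡⟨ cong (punchIn x) (sym eq) ⟩
      punchIn x i      ≡⟨ punchIn-punchOut (≢-sym y≢x) ⟩
      y                ∎)
      where open ≡-Reasoning
    j : Fin (5 + k)
    j = punchOut i≢i′
    word≡ : map (triple x y z) (shape p) ≡ cycleWordOf x ((p , j) , i)
    word≡ rewrite punchIn-punchOut i≢i′ | punchIn-punchOut (≢-sym y≢x) | punchIn-punchOut (≢-sym z≢x) = refl

  sixCycles-large : CycleRegular (FQV (7 + k)) (FQAdj (7 + k)) 1 (4 * (5 + k) * (6 + k)) 6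
  sixCycles-large = cycleRegular-by-words (s≤s (s≤s (s≤s z≤n))) cycleWords distinct sound complete
                      (λ x → length-tabulate (cycleWordOf x ∘ decode))
    where
    cycleWords : Fin (7 + k) → List (List (Fin (7 + k)))
    cycleWords x = tabulate (cycleWordOf x ∘ decode)
    distinct : ∀ x → Unique (cycleWords x)
    distinct x = Unique.tabulate⁺ (decode-injective ∘ cycleWordOf-injective x)
    sound : ∀ x a w → w ∈ cycleWords x → CycleWord 6 a (x ∷ w)
    sound x a w w∈ with ∈-tabulate⁻ {f = cycleWordOf x ∘ decode} w∈
    ... | t , refl = cycleWordOf-cycleWord x (decode t) a
    complete : ∀ x a w → CycleWord 6 a (x ∷ w) → w ∈ cycleWords x
    complete x a w cw with shaped⇒cycleWordOf x w (cycleWord⇒shaped a x w cw)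
    ... | c , refl = subst (λ c′ → cycleWordOf x c′ ∈ cycleWords x) (decode∘encode c)
                           (∈-tabulate⁺ {f = cycleWordOf x ∘ decode} (encode c))

theorem6 : CycleRegular (FQV 1) (FQAdj 1) 1 0 6
             × CycleRegular (FQV 2) (FQAdj 2) 1 0 6
             × CycleRegular (FQV 3) (FQAdj 3) 1 0 6
             × CycleRegular (FQV 4) (FQAdj 4) 1 36 6
             × CycleRegular (FQV 6) (FQAdj 6) 1 200 6
             × (∀ (n : ℕ) → 1 ≤ n → n ≢ 1 → n ≢ 2 → n ≢ 3 → n ≢ 4 → n ≢ 6
                  → CycleRegular (FQV n) (FQAdj n) 1 (4 * (n ∸ 2) * (n ∸ 1)) 6)
theorem6 = no-cycles FQ₁-no-three-distinct , no-cycles FQ₂-no-three-distinct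
         , sixCycles-by-enumeration 0 0 , sixCycles-by-enumeration 1 36 , sixCycles-by-enumeration 3 200
         , other-n
  where
  other-n : ∀ (n : ℕ) → 1 ≤ n → n ≢ 1 → n ≢ 2 → n ≢ 3 → n ≢ 4 → n ≢ 6
            → CycleRegular (FQV n) (FQAdj n) 1 (4 * (n ∸ 2) * (n ∸ 1)) 6
  other-n 1 _ n≢1 _ _ _ _ = ⊥-elim (n≢1 refl)
  other-n 2 _ _ n≢2 _ _ _ = ⊥-elim (n≢2 refl)
  other-n 3 _ _ _ n≢3 _ _ = ⊥-elim (n≢3 refl)
  other-n 4 _ _ _ _ n≢4 _ = ⊥-elim (n≢4 refl)
  -- the parity argument needs n ≥ 7, so n = 5 is counted directly
  other-n 5 _ _ _ _ _ _   = sixCycles-by-enumeration 2 48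
  other-n 6 _ _ _ _ _ n≢6 = ⊥-elim (n≢6 refl)
  other-n (suc (suc (suc (suc (suc (suc (suc k))))))) _ _ _ _ _ _ = sixCycles-large k
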